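{- Let $G$ be a cubic $2$-connected planar graph on $n$ vertices and let $M=\{(x_0,x'_0),\dots,(x_{n/2-1},x'_{n/2-1})\}$ be a perfect matching of $G$. Let $\hat G$ be obtained from $G$ by, for each $0\le i<n/2$, deleting the edge $x_ix'_i$, adding six new vertices $s_i,a_i,b_i,b'_i,a'_i,t_i$, and adding the edges $x_is_i,\ t_ix'_i,\ s_ia_i,\ a_ib_i,\ b_ib'_i,\ b'_ia'_i,\ a'_it_i,\ s_it_i,\ t_ib_i,\ b_ia'_i,\ a'_ia_i,\ a_ib'_i,\ b'_is_i$. Then for every integer $p$, $G$ has a vertex cover of size at most $p$ if and only if $\hat G$ has a vertex cover of size at most $p+2n$.
   Context: A vertex cover of a graph is a vertex set meeting every edge. -}

module Defs where

open import Data.Nat using (ℕ; zero; suc; _+_; _≤_; _/_)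
open import Data.Integer using (ℤ; +_) renaming (_≤_ to _≤ℤ_)
open import Data.Fin using (Fin)
open import Data.Fin.Subset using (∣_∣)
open import Data.Vec using (tabulate; sum)
open import Data.Bool using (Bool; true; false)
open import Data.Product using (Σ; ∃; _×_; _,_)
open import Data.Sum using (_⊎_; inj₁; inj₂)
open import Data.List using (List; length)
open import Data.List.Membership.Propositional using (_∈_)
open import Data.List.Relation.Unary.All using (All)
open import Data.List.Relation.Unary.Unique.Propositional using (Unique)
open import Relation.Binary.PropositionalEquality using (_≡_; _≢_)
open import Relation.Nullary using (¬_)

record Graph (n : ℕ) : Set where
  field
    adj    : Fin n → Fin n → Bool
    sym    : ∀ u v → adj u v ≡ adj v u
    irrefl : ∀ u → adj u u ≡ false
open Graph public

Edge : ∀ {n} → Graph n → Fin n → Fin n → Set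
Edge G u v = adj G u v ≡ true

degree : ∀ {n} → Graph n → Fin n → ℕ
degree G u = ∣ tabulate (adj G u) ∣

numEdges : ∀ {n} → Graph n → ℕ
numEdges {n} G = sum (tabulate (degree G)) / 2

Cubic : ∀ {n} → Graph n → Set
Cubic G = ∀ u → degree G u ≡ 3

data WalkAvoiding {n} (G : Graph n) (v : Fin n) : Fin n → Fin n → Set where
  here : ∀ {u} → WalkAvoiding G v u u
  step : ∀ {u w z} → Edge G u w → w ≢ v → WalkAvoiding G v w z → WalkAvoiding G v u z

TwoConnected : ∀ {n} → Graph n → Set
TwoConnected {n} G =
  3 ≤ n × (∀ v u w → u ≢ v → w ≢ v → WalkAvoiding G v u w)

-- Planarity, combinatorially: a rotation system (combinatorial embedding)
-- whose faces satisfy Euler's formula  V - E + F = 2  (genus 0).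

iter : ∀ {A : Set} → (A → A) → ℕ → A → A
iter f zero    a = a
iter f (suc k) a = f (iter f k a)

IsRotationSystem : ∀ {n} → Graph n → (Fin n → Fin n → Fin n) → Set
IsRotationSystem G rot =
  (∀ v u → Edge G v u → Edge G v (rot v u)) ×
  (∀ v u w → Edge G v u → Edge G v w → ∃ λ k → iter (rot v) k u ≡ w)

Dart : ∀ {n} → Graph n → Fin n × Fin n → Set
Dart G (u , v) = Edge G u v

facePerm : ∀ {n} → (Fin n → Fin n → Fin n) → Fin n × Fin n → Fin n × Fin n
facePerm rot (u , v) = (v , rot v u)

InOrbit : ∀ {A : Set} → (A → A) → A → A → Set
InOrbit f a b = ∃ λ k → iter f k a ≡ b

FaceRepresentatives : ∀ {n} → Graph n → (Fin n → Fin n → Fin n) →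
                      List (Fin n × Fin n) → Set
FaceRepresentatives G rot R =
  All (Dart G) R × Unique R ×
  (∀ d → Dart G d → ∃ λ r → r ∈ R × InOrbit (facePerm rot) r d) ×
  (∀ r r' → r ∈ R → r' ∈ R → InOrbit (facePerm rot) r r' → r ≡ r')

Planar : ∀ {n} → Graph n → Set
Planar {n} G =
  Σ (Fin n → Fin n → Fin n) λ rot → IsRotationSystem G rot ×
  Σ (List (Fin n × Fin n)) λ R → FaceRepresentatives G rot R ×
  n + length R ≡ numEdges G + 2

-- Perfect matching M = {(x i , x' i) | i < n/2}: each pair is an edge and
-- the map  inj₁ i ↦ x i, inj₂ i ↦ x' i  is a bijection onto the vertices.

endpoint : ∀ {n k} → (x x' : Fin k → Fin n) → Fin k ⊎ Fin k → Fin n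
endpoint x x' (inj₁ i) = x i
endpoint x x' (inj₂ i) = x' i

IsPerfectMatching : ∀ {n} → Graph n → (x x' : Fin (n / 2) → Fin n) → Set
IsPerfectMatching {n} G x x' =
  (∀ i → Edge G (x i) (x' i)) ×
  (∀ p q → endpoint x x' p ≡ endpoint x x' q → p ≡ q) ×
  (∀ v → ∃ λ p → endpoint x x' p ≡ v)

data Gadget : Set where
  s a b b' a' t : Gadget

data GadgetEdge : Gadget → Gadget → Set where
  sa   : GadgetEdge s a
  ab   : GadgetEdge a b
  bb'  : GadgetEdge b b'
  b'a' : GadgetEdge b' a'
  a't  : GadgetEdge a' t
  st   : GadgetEdge s t
  tb   : GadgetEdge t b
  ba'  : GadgetEdge b a'
  a'a  : GadgetEdge a' a
  ab'  : GadgetEdge a b'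
  b's  : GadgetEdge b' s

-- vertices of Ĝ: old vertices, and (i , g) = gadget vertex g_i
HatV : ℕ → Set
HatV n = Fin n ⊎ (Fin (n / 2) × Gadget)

InMatching : ∀ {n} (x x' : Fin (n / 2) → Fin n) → Fin n → Fin n → Set
InMatching x x' u v = ∃ λ i → (x i ≡ u × x' i ≡ v) ⊎ (x i ≡ v × x' i ≡ u)

data HatEdge₀ {n} (G : Graph n) (x x' : Fin (n / 2) → Fin n) : HatV n → HatV n → Set where
  old : ∀ {u v} → Edge G u v → ¬ InMatching x x' u v → HatEdge₀ G x x' (inj₁ u) (inj₁ v)
  xs  : ∀ i → HatEdge₀ G x x' (inj₁ (x i)) (inj₂ (i , s))
  tx' : ∀ i → HatEdge₀ G x x' (inj₂ (i , t)) (inj₁ (x' i))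
  gad : ∀ i {g h} → GadgetEdge g h → HatEdge₀ G x x' (inj₂ (i , g)) (inj₂ (i , h))

HatEdge : ∀ {n} (G : Graph n) (x x' : Fin (n / 2) → Fin n) → HatV n → HatV n → Set
HatEdge G x x' u v = HatEdge₀ G x x' u v ⊎ HatEdge₀ G x x' v u

IsVertexCover : ∀ {V : Set} → (V → V → Set) → List V → Set
IsVertexCover {V} E C = Unique C × (∀ u v → E u v → u ∈ C ⊎ v ∈ C)

HasVertexCoverOfSizeAtMost : ∀ {V : Set} → (V → V → Set) → ℤ → Set
HasVertexCoverOfSizeAtMost {V} E p =
  Σ (List V) λ C → IsVertexCover E C × (+ length C) ≤ℤ p

module Submission where

-- The reduction G ↦ Ĝ is local to the matching edges.  The vertices of G split into
-- the blocks {x i, x' i}, those of Ĝ into the blocks {x i, x' i} ∪ gadget i, and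
-- Ĝ has no edge between gadgets of different blocks.
--
-- The gadget: its 11 edges contain the vertex-disjoint triangles s a b' and t b a',
-- so a cover of the gadget uses at least 4 of its vertices, and at least 5 when
-- both s and t are forced, i.e. when neither x i nor x' i is selected; the sets
-- {s, b, b', a'} and {a, b', a', t} are covers of size 4.
--   Forward:  add {s, b, b', a'} when x' i is selected, {a, b', a', t} otherwise.
--   Backward: keep the old vertices and add x i whenever x' i is unselected;
--             the fifth gadget vertex pays for x i.
-- Each block thus shifts the count by exactly 4; with n = 2 · (n / 2) (the matching
-- is perfect) the total shift is 4 · (n / 2) = 2n.

open import Defs hiding (sym)
open import Algebra.Bundles using (AbelianGroup)
open import Data.Bool using (Bool; true; false; _∨_; not; T)
open import Data.Bool.Properties using (T-∨; ∨-comm; ∨-identityʳ)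
open import Data.Empty using (⊥-elim)
open import Data.Fin using (Fin; #_) renaming (_≟_ to _≟ᶠ_)
open import Data.Fin.Permutation using (↔⇒≡)
open import Data.Fin.Properties using (+↔⊎; any?)
open import Data.Integer using (ℤ; +_; _+_; _*_; -_; +≤+) renaming (_≤_ to _≤ℤ_)
import Data.Integer.Properties as ℤ
open import Data.Nat using (ℕ; suc; _≤_; z≤n; s≤s; s≤s⁻¹; _/_) renaming (_+_ to _+ℕ_; _*_ to _*ℕ_)
open import Data.Nat.Properties
  using (+-assoc; ≤-trans; ≤-reflexive; +-mono-≤; +-monoˡ-≤; +-commutativeSemigroup; module ≤-Reasoning)
open import Data.Nat.Solver using (module +-*-Solver)
open import Data.List using (List; []; _∷_; _++_; length; map; concatMap; filterᵇ; allFin; lookup)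
open import Data.List.Properties using (length-removeAt′; length-tabulate)
open import Data.List.Membership.Propositional using (_∈_; _─_)
open import Data.List.Membership.Propositional.Properties
  using (∈-filter⁺; ∈-filter⁻; ∈-map⁺; ∈-map⁻; ∈-++⁺ˡ; ∈-++⁺ʳ; ∈-++⁻; ∈-allFin; ∈-concatMap⁺; ∈-lookup)
import Data.List.Membership.DecPropositional as DecMembership
open import Data.List.Relation.Binary.Disjoint.Propositional using (Disjoint)
open import Data.List.Relation.Unary.Any as Any using (here; there; index)
open import Data.List.Relation.Unary.All as All using (All; []; _∷_)
import Data.List.Relation.Unary.All.Properties as Allₚ
open import Data.List.Relation.Unary.AllPairs as AllPairs using (AllPairs; []; _∷_)
import Data.List.Relation.Unary.AllPairs.Properties as AllPairsₚ
open import Data.List.Relation.Unary.Unique.Propositional using (Unique)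
import Data.List.Relation.Unary.Unique.Propositional.Properties as Uniqueₚ
open import Data.List.Relation.Unary.Unique.DecPropositional using (unique?)
open import Data.Product using (Σ; _×_; _,_; proj₁; proj₂)
import Data.Product.Properties as Product
open import Data.Sum using (_⊎_; inj₁; inj₂; reduce)
import Data.Sum as Sum
import Data.Sum.Properties as Sum
open import Function using (_∘_)
open import Function.Bundles using (_⇔_; mk⇔; Equivalence; mk↔ₛ′)
open import Function.Construct.Composition using (_↔-∘_)
open import Relation.Binary.Definitions using (DecidableEquality)
open import Relation.Binary.PropositionalEquality
  using (_≡_; _≢_; refl; sym; trans; cong; cong₂; subst; subst₂; module ≡-Reasoning)
open import Relation.Nullary.Decidable
  using (Dec; yes; no; T?; isYes; fromWitness; toWitness; map′; from-yes; _×-dec_; _⊎-dec_)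
open import Algebra.Properties.Group (AbelianGroup.group ℤ.+-0-abelianGroup) using (//-rightDividesʳ)
open import Algebra.Properties.CommutativeSemigroup +-commutativeSemigroup using (interchange)

ind : Bool → ℕ
ind true  = 1
ind false = 0

count : {V : Set} → (V → Bool) → List V → ℕ
count χ []       = 0
count χ (v ∷ vs) = ind (χ v) +ℕ count χ vs

count-++ : {V : Set} (χ : V → Bool) (us vs : List V) → count χ (us ++ vs) ≡ count χ us +ℕ count χ vs
count-++ χ []       vs = refl
count-++ χ (u ∷ us) vs = trans (cong (ind (χ u) +ℕ_) (count-++ χ us vs)) (sym (+-assoc (ind (χ u)) _ _))

count-selected : {V : Set} (χ : V → Bool) {v : V} (vs : List V) → T (χ v) → count χ (v ∷ vs) ≡ suc (count χ vs)
count-selected χ {v} vs _ with χ v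
... | true = refl

length-filterᵇ : {V : Set} (χ : V → Bool) (vs : List V) → length (filterᵇ χ vs) ≡ count χ vs
length-filterᵇ χ []       = refl
length-filterᵇ χ (v ∷ vs) with χ v
... | true  = cong suc (length-filterᵇ χ vs)
... | false = length-filterᵇ χ vs

∈-─ : {V : Set} {us : List V} {u v : V} (u∈us : u ∈ us) → v ∈ us → v ≢ u → v ∈ us ─ u∈us
∈-─ (here refl)  (here refl) v≢u = ⊥-elim (v≢u refl)
∈-─ (here _)     (there v∈)  _   = v∈
∈-─ (there u∈us) (here refl) _   = here refl
∈-─ (there u∈us) (there v∈)  v≢u = there (∈-─ u∈us v∈ v≢u)

length-≤-of-⊆ : {V : Set} {us ws : List V} → Unique us → (∀ {v} → v ∈ us → v ∈ ws) → length us ≤ length ws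
length-≤-of-⊆ [] _ = z≤n
length-≤-of-⊆ {us = u ∷ us} {ws} (u∉us ∷ us-unique) us⊆ws =
  ≤-trans (s≤s (length-≤-of-⊆ us-unique us⊆ws─u)) (≤-reflexive (sym (length-removeAt′ ws (index u∈ws))))
  where
  u∈ws : u ∈ ws
  u∈ws = us⊆ws (here refl)
  us⊆ws─u : ∀ {v} → v ∈ us → v ∈ ws ─ u∈ws
  us⊆ws─u v∈us = ∈-─ u∈ws (us⊆ws (there v∈us)) (λ v≡u → All.lookup u∉us v∈us (sym v≡u))

record Enumeration (V : Set) : Set where
  field
    elements : List V
    unique   : Unique elements
    complete : ∀ v → v ∈ elements
open Enumeration

finEnumeration : ∀ k → Enumeration (Fin k)
finEnumeration k = record { elements = allFin k ; unique = Uniqueₚ.allFin⁺ k ; complete = ∈-allFin }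

Covers : {V : Set} → (V → V → Set) → (V → Bool) → Set
Covers E χ = ∀ u v → E u v → T (χ u ∨ χ v)

Covers-symmetric : {V : Set} {E₀ : V → V → Set} {χ : V → Bool} →
                   (∀ {u v} → E₀ u v → T (χ u ∨ χ v)) → Covers (λ u v → E₀ u v ⊎ E₀ v u) χ
Covers-symmetric covers₀ u v (inj₁ e) = covers₀ e
Covers-symmetric {χ = χ} covers₀ u v (inj₂ e) = subst T (∨-comm (χ v) (χ u)) (covers₀ e)

module _ {V : Set} {E : V → V → Set} (vertices : Enumeration V) where

  selectionOf : DecidableEquality V → (C : List V) → IsVertexCover E C →
                Σ (V → Bool) λ χ → Covers E χ × count χ (elements vertices) ≤ length C
  selectionOf _≟_ C (_ , C-covers) = χ , χ-covers , χ-size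
    where
    open DecMembership _≟_ using (_∈?_)
    χ : V → Bool
    χ v = isYes (v ∈? C)
    χ-covers : Covers E χ
    χ-covers u v e = Equivalence.from T-∨
      (Sum.map (fromWitness {a? = u ∈? C}) (fromWitness {a? = v ∈? C}) (C-covers u v e))
    selected⊆C : ∀ {v} → v ∈ filterᵇ χ (elements vertices) → v ∈ C
    selected⊆C {v} = toWitness {a? = v ∈? C} ∘ proj₂ ∘ ∈-filter⁻ (T? ∘ χ) {xs = elements vertices}
    χ-size : count χ (elements vertices) ≤ length C
    χ-size = ≤-trans (≤-reflexive (sym (length-filterᵇ χ (elements vertices))))
                     (length-≤-of-⊆ (Uniqueₚ.filter⁺ (T? ∘ χ) (unique vertices)) selected⊆C)

  coverOf : (χ : V → Bool) → Covers E χ → IsVertexCover E (filterᵇ χ (elements vertices))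
  coverOf χ χ-covers =
    Uniqueₚ.filter⁺ (T? ∘ χ) (unique vertices) ,
    λ u v e → Sum.map (listed u) (listed v) (Equivalence.to T-∨ (χ-covers u v e))
    where
    listed : ∀ w → T (χ w) → w ∈ filterᵇ χ (elements vertices)
    listed w = ∈-filter⁺ (T? ∘ χ) (complete vertices w)

+-shift-≤ : ∀ {d c} m {p} → d ≤ c +ℕ m → + c ≤ℤ p → + d ≤ℤ p + + m
+-shift-≤ {d} {c} m {p} d≤c+m c≤p = begin
  + d              ≤⟨ +≤+ d≤c+m ⟩
  + (c +ℕ m)       ≡⟨ ℤ.pos-+ c m ⟩
  + c + + m        ≤⟨ ℤ.+-monoˡ-≤ (+ m) c≤p ⟩
  p + + m          ∎
  where open ℤ.≤-Reasoning

+-unshift-≤ : ∀ {c d} m {p} → c +ℕ m ≤ d → + d ≤ℤ p + + m → + c ≤ℤ p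
+-unshift-≤ {c} {d} m {p} c+m≤d d≤p+m =
  subst₂ _≤ℤ_ (//-rightDividesʳ (+ m) (+ c)) (//-rightDividesʳ (+ m) p) (ℤ.+-monoˡ-≤ (- + m) c+m≤p+m)
  where
  open ℤ.≤-Reasoning
  c+m≤p+m : + c + + m ≤ℤ p + + m
  c+m≤p+m = begin
    + c + + m      ≡⟨ ℤ.pos-+ c m ⟨
    + (c +ℕ m)     ≤⟨ +≤+ c+m≤d ⟩
    + d            ≤⟨ d≤p+m ⟩
    p + + m        ∎

module _ {V W : Set} {E : V → V → Set} {F : W → W → Set}
         (vertices : Enumeration V) (_≟V_ : DecidableEquality V)
         (vertices' : Enumeration W) (_≟W_ : DecidableEquality W) (m : ℕ) where

  coverSizes-shift :
    (∀ χ → Covers E χ → Σ (W → Bool) λ ψ → Covers F ψ × count ψ (elements vertices') ≤ count χ (elements vertices) +ℕ m) →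
    (∀ ψ → Covers F ψ → Σ (V → Bool) λ χ → Covers E χ × count χ (elements vertices) +ℕ m ≤ count ψ (elements vertices')) →
    ∀ p → HasVertexCoverOfSizeAtMost E p ⇔ HasVertexCoverOfSizeAtMost F (p + + m)
  coverSizes-shift forward backward p = mk⇔ enlarge shrink
    where
    enlarge : HasVertexCoverOfSizeAtMost E p → HasVertexCoverOfSizeAtMost F (p + + m)
    enlarge (C , C-cover , C-size) =
      let χ , χ-covers , χ-size = selectionOf vertices _≟V_ C C-cover
          ψ , ψ-covers , ψ-size = forward χ χ-covers
      in filterᵇ ψ (elements vertices') , coverOf vertices' ψ ψ-covers ,
         +-shift-≤ m (≤-trans (≤-reflexive (length-filterᵇ ψ (elements vertices')))
                               (≤-trans ψ-size (+-monoˡ-≤ m χ-size))) C-size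

    shrink : HasVertexCoverOfSizeAtMost F (p + + m) → HasVertexCoverOfSizeAtMost E p
    shrink (D , D-cover , D-size) =
      let ψ , ψ-covers , ψ-size = selectionOf vertices' _≟W_ D D-cover
          χ , χ-covers , χ-size = backward ψ ψ-covers
      in filterᵇ χ (elements vertices) , coverOf vertices χ χ-covers ,
         +-unshift-≤ m (≤-trans (≤-reflexive (cong (_+ℕ m) (length-filterᵇ χ (elements vertices))))
                                 (≤-trans χ-size ψ-size)) D-size

module _ {I V : Set} (indices : Enumeration I) (block : I → List V) (owner : V → I)
         (block-unique : ∀ i → Unique (block i))
         (block-owner : ∀ {i v} → v ∈ block i → owner v ≡ i)
         (block-complete : ∀ v → v ∈ block (owner v)) where

  blockEnumeration : Enumeration V
  blockEnumeration = record
    { elements = concatMap block (elements indices)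
    ; unique   = Uniqueₚ.concat⁺ (Allₚ.map⁺ (All.universal block-unique _))
                                 (AllPairsₚ.map⁺ (AllPairs.map disjoint (unique indices)))
    ; complete = λ v → ∈-concatMap⁺ block (Any.map (λ { refl → block-complete v }) (complete indices (owner v)))
    }
    where
    disjoint : ∀ {i j} → i ≢ j → Disjoint (block i) (block j)
    disjoint i≢j (v∈i , v∈j) = i≢j (trans (sym (block-owner v∈i)) (block-owner v∈j))

module _ {I V W : Set} (χ : V → Bool) (ψ : W → Bool) (A : I → List V) (B : I → List W) (m : ℕ) where

  count-blocks-≡ : (∀ i → count ψ (B i) ≡ count χ (A i) +ℕ m) →
                   ∀ is → count ψ (concatMap B is) ≡ count χ (concatMap A is) +ℕ length is *ℕ m
  count-blocks-≡ block-eq []       = refl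
  count-blocks-≡ block-eq (i ∷ is) = begin
    count ψ (B i ++ concatMap B is)
      ≡⟨ count-++ ψ (B i) _ ⟩
    count ψ (B i) +ℕ count ψ (concatMap B is)
      ≡⟨ cong₂ _+ℕ_ (block-eq i) (count-blocks-≡ block-eq is) ⟩
    (count χ (A i) +ℕ m) +ℕ (count χ (concatMap A is) +ℕ length is *ℕ m)
      ≡⟨ interchange (count χ (A i)) m (count χ (concatMap A is)) (length is *ℕ m) ⟩
    (count χ (A i) +ℕ count χ (concatMap A is)) +ℕ (m +ℕ length is *ℕ m)
      ≡⟨ cong (_+ℕ (m +ℕ length is *ℕ m)) (count-++ χ (A i) _) ⟨
    count χ (A i ++ concatMap A is) +ℕ (m +ℕ length is *ℕ m)
      ∎
    where open ≡-Reasoning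

  count-blocks-≤ : (∀ i → count χ (A i) +ℕ m ≤ count ψ (B i)) →
                   ∀ is → count χ (concatMap A is) +ℕ length is *ℕ m ≤ count ψ (concatMap B is)
  count-blocks-≤ block-le []       = z≤n
  count-blocks-≤ block-le (i ∷ is) = begin
    count χ (A i ++ concatMap A is) +ℕ (m +ℕ length is *ℕ m)
      ≡⟨ cong (_+ℕ (m +ℕ length is *ℕ m)) (count-++ χ (A i) _) ⟩
    (count χ (A i) +ℕ count χ (concatMap A is)) +ℕ (m +ℕ length is *ℕ m)
      ≡⟨ interchange (count χ (A i)) (count χ (concatMap A is)) m (length is *ℕ m) ⟩
    (count χ (A i) +ℕ m) +ℕ (count χ (concatMap A is) +ℕ length is *ℕ m)
      ≤⟨ +-mono-≤ (block-le i) (count-blocks-≤ block-le is) ⟩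
    count ψ (B i) +ℕ count ψ (concatMap B is)
      ≡⟨ count-++ ψ (B i) _ ⟨
    count ψ (B i ++ concatMap B is)
      ∎
    where open ≤-Reasoning

all-selected : {V : Set} (c : V → Bool) (vs : List V) → All (T ∘ c) vs → length vs ≤ count c vs
all-selected c []       []         = z≤n
all-selected c (v ∷ vs) (cv ∷ cvs) = ≤-trans (s≤s (all-selected c vs cvs)) (≤-reflexive (sym (count-selected c vs cv)))

clique-cover : {V : Set} (c : V → Bool) (vs : List V) → AllPairs (λ u v → T (c u ∨ c v)) vs → length vs ≤ suc (count c vs)
clique-cover c []       []                 = z≤n
clique-cover c (v ∷ vs) (v-pairs ∷ pairs) with c v | v-pairs
... | true  | _          = s≤s (clique-cover c vs pairs)
... | false | neighbours = s≤s (all-selected c vs neighbours)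

-- ordered so that the triangles s a b' and t b a' are consecutive
gadgetVertices : List Gadget
gadgetVertices = s ∷ a ∷ b' ∷ t ∷ b ∷ a' ∷ []

gadgetIndex : Gadget → Fin 6
gadgetIndex s  = # 0
gadgetIndex a  = # 1
gadgetIndex b' = # 2
gadgetIndex t  = # 3
gadgetIndex b  = # 4
gadgetIndex a' = # 5

lookup-gadgetIndex : ∀ g → lookup gadgetVertices (gadgetIndex g) ≡ g
lookup-gadgetIndex s  = refl
lookup-gadgetIndex a  = refl
lookup-gadgetIndex b' = refl
lookup-gadgetIndex t  = refl
lookup-gadgetIndex b  = refl
lookup-gadgetIndex a' = refl

_≟G_ : DecidableEquality Gadget
g ≟G h = map′ index-injective (cong gadgetIndex) (gadgetIndex g ≟ᶠ gadgetIndex h)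
  where
  index-injective : gadgetIndex g ≡ gadgetIndex h → g ≡ h
  index-injective eq =
    trans (sym (lookup-gadgetIndex g)) (trans (cong (lookup gadgetVertices) eq) (lookup-gadgetIndex h))

gadgetVertices-unique : Unique gadgetVertices
gadgetVertices-unique = from-yes (unique? _≟G_ gadgetVertices)

gadgetVertices-complete : ∀ g → g ∈ gadgetVertices
gadgetVertices-complete g = subst (_∈ gadgetVertices) (lookup-gadgetIndex g) (∈-lookup (gadgetIndex g))

GadgetCovered : (Gadget → Bool) → Set
GadgetCovered c = ∀ {g h} → GadgetEdge g h → T (c g ∨ c h)

module _ (c : Gadget → Bool) (covered : GadgetCovered c) where

  private
    covered⁻ : ∀ {g h} → GadgetEdge h g → T (c g ∨ c h)
    covered⁻ {g} {h} e = subst T (∨-comm (c h) (c g)) (covered e)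

    triangle : ∀ {u v w} → AllPairs (λ g h → T (c g ∨ c h)) (u ∷ v ∷ w ∷ []) → 2 ≤ count c (u ∷ v ∷ w ∷ [])
    triangle = s≤s⁻¹ ∘ clique-cover c _

  -- each of the disjoint triangles s a b' and t b a' needs two vertices
  gadget-≥4 : 4 ≤ count c gadgetVertices
  gadget-≥4 = subst (4 ≤_) (sym (count-++ c (s ∷ a ∷ b' ∷ []) (t ∷ b ∷ a' ∷ [])))
    (+-mono-≤ (triangle ((covered sa ∷ covered⁻ b's ∷ []) ∷ (covered ab' ∷ []) ∷ [] ∷ []))
              (triangle ((covered tb ∷ covered⁻ a't ∷ []) ∷ (covered ba' ∷ []) ∷ [] ∷ [])))

  -- with s and t selected, a b' t b a' are pairwise covered (a b' b a' is a 4-clique)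
  gadget-≥5 : T (c s) → T (c t) → 5 ≤ count c gadgetVertices
  gadget-≥5 cs ct = subst (5 ≤_) (sym (count-selected c (a ∷ b' ∷ t ∷ b ∷ a' ∷ []) cs))
    (s≤s (s≤s⁻¹ (clique-cover c (a ∷ b' ∷ t ∷ b ∷ a' ∷ [])
      ( (covered ab' ∷ by-t ∷ covered ab ∷ covered⁻ a'a ∷ [])
      ∷ (by-t ∷ covered⁻ bb' ∷ covered b'a' ∷ [])
      ∷ (covered tb ∷ covered⁻ a't ∷ [])
      ∷ (covered ba' ∷ [])
      ∷ [] ∷ []))))
    where
    by-t : ∀ {g} → T (c g ∨ c t)
    by-t = Equivalence.from T-∨ (inj₂ ct)

-- the 4-vertex cover {s, b, b', a'} if β (x' is selected), else {a, b', a', t}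
gadgetChoice : Bool → Gadget → Bool
gadgetChoice β s  = β
gadgetChoice β a  = not β
gadgetChoice β b  = β
gadgetChoice β b' = true
gadgetChoice β a' = true
gadgetChoice β t  = not β

gadgetChoice-size : ∀ β → count (gadgetChoice β) gadgetVertices ≡ 4
gadgetChoice-size true  = refl
gadgetChoice-size false = refl

gadgetChoice-covers : ∀ β → GadgetCovered (gadgetChoice β)
gadgetChoice-covers true  = λ { sa → _ ; ab → _ ; bb' → _ ; b'a' → _ ; a't → _ ; st → _
                              ; tb → _ ; ba' → _ ; a'a → _ ; ab' → _ ; b's → _ }
gadgetChoice-covers false = λ { sa → _ ; ab → _ ; bb' → _ ; b'a' → _ ; a't → _ ; st → _
                              ; tb → _ ; ba' → _ ; a'a → _ ; ab' → _ ; b's → _ }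

repair-covers : ∀ p q → T ((p ∨ not q) ∨ q)
repair-covers true  _     = _
repair-covers false true  = _
repair-covers false false = _

-- the added vertex costs at most the surplus of the gadget over four vertices
repair-cost : ∀ p q {g} → 4 ≤ g → (p ≡ false → q ≡ false → 5 ≤ g) →
              ind (p ∨ not q) +ℕ (ind q +ℕ 0) +ℕ 4 ≤ ind p +ℕ (ind q +ℕ g)
repair-cost true  true  g≥4 _   = s≤s (s≤s g≥4)
repair-cost true  false g≥4 _   = s≤s g≥4
repair-cost false true  g≥4 _   = s≤s g≥4
repair-cost false false _   g≥5 = g≥5 refl refl

∨-weaken : ∀ p q {p' q'} → T (p ∨ q) → T ((p ∨ p') ∨ (q ∨ q'))
∨-weaken p q {p'} =
  Equivalence.from (T-∨ {p ∨ p'}) ∘ Sum.map (Equivalence.from (T-∨ {p}) ∘ inj₁) (Equivalence.from (T-∨ {q}) ∘ inj₁)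
  ∘ Equivalence.to T-∨

resolveˡ : ∀ {p q} → p ≡ false → T (p ∨ q) → T q
resolveˡ refl q = q

resolveʳ : ∀ {p q} → q ≡ false → T (p ∨ q) → T p
resolveʳ {p} refl = subst T (∨-identityʳ p)

module Matching {n : ℕ} {G : Graph n} {x x' : Fin (n / 2) → Fin n} (matching : IsPerfectMatching G x x') where

  k : ℕ
  k = n / 2

  matched : ∀ i → Edge G (x i) (x' i)
  matched = proj₁ matching

  endpoint-injective : ∀ p q → endpoint x x' p ≡ endpoint x x' q → p ≡ q
  endpoint-injective = proj₁ (proj₂ matching)

  -- the matching edge containing v, and the side of v in it
  side : Fin n → Fin k ⊎ Fin k
  side v = proj₁ (proj₂ (proj₂ matching) v)

  endpoint-side : ∀ v → endpoint x x' (side v) ≡ v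
  endpoint-side v = proj₂ (proj₂ (proj₂ matching) v)

  side-endpoint : ∀ p → side (endpoint x x' p) ≡ p
  side-endpoint p = endpoint-injective _ _ (endpoint-side (endpoint x x' p))

  vertex-count : n ≡ k +ℕ k
  vertex-count = sym (↔⇒≡ (mk↔ₛ′ (endpoint x x') side endpoint-side side-endpoint ↔-∘ +↔⊎))

  twice-order : + 2 * + n ≡ + (k *ℕ 4)
  twice-order = begin
    + 2 * + n           ≡⟨ ℤ.pos-* 2 n ⟨
    + (2 *ℕ n)          ≡⟨ cong (λ m → + (2 *ℕ m)) vertex-count ⟩
    + (2 *ℕ (k +ℕ k))   ≡⟨ cong +_ (solve 1 (λ m → con 2 :* (m :+ m) := m :* con 4) refl k) ⟩
    + (k *ℕ 4)          ∎
    where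
    open ≡-Reasoning
    open +-*-Solver

  owner : Fin n → Fin k
  owner v = reduce (side v)

  pairBlock : Fin k → List (Fin n)
  pairBlock i = x i ∷ x' i ∷ []

  pairBlock-unique : ∀ i → Unique (pairBlock i)
  pairBlock-unique i = (x≢x' ∷ []) ∷ [] ∷ []
    where
    x≢x' : x i ≢ x' i
    x≢x' eq with endpoint-injective (inj₁ i) (inj₂ i) eq
    ... | ()

  pairBlock-owner : ∀ {i v} → v ∈ pairBlock i → owner v ≡ i
  pairBlock-owner {i} (here refl)         = cong reduce (side-endpoint (inj₁ i))
  pairBlock-owner {i} (there (here refl)) = cong reduce (side-endpoint (inj₂ i))

  pairBlock-complete : ∀ v → v ∈ pairBlock (owner v)
  pairBlock-complete v with side v | endpoint-side v
  ... | inj₁ i | refl = here refl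
  ... | inj₂ i | refl = there (here refl)

  vertexEnumeration : Enumeration (Fin n)
  vertexEnumeration =
    blockEnumeration (finEnumeration k) pairBlock owner pairBlock-unique pairBlock-owner pairBlock-complete

  hatBlock : Fin k → List (HatV n)
  hatBlock i = map inj₁ (pairBlock i) ++ map (λ g → inj₂ (i , g)) gadgetVertices

  hatOwner : HatV n → Fin k
  hatOwner (inj₁ v)       = owner v
  hatOwner (inj₂ (i , _)) = i

  hatBlock-unique : ∀ i → Unique (hatBlock i)
  hatBlock-unique i = Uniqueₚ.++⁺ (Uniqueₚ.map⁺ Sum.inj₁-injective (pairBlock-unique i))
                                  (Uniqueₚ.map⁺ gadget-injective gadgetVertices-unique) old≢gadget
    where
    gadget-injective : ∀ {g h} → _≡_ {A = HatV n} (inj₂ (i , g)) (inj₂ (i , h)) → g ≡ h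
    gadget-injective refl = refl
    old≢gadget : Disjoint (map inj₁ (pairBlock i)) (map (λ g → inj₂ (i , g)) gadgetVertices)
    old≢gadget (old-v , gadget-v) with ∈-map⁻ inj₁ old-v | ∈-map⁻ (λ g → inj₂ (i , g)) gadget-v
    ... | _ , _ , refl | _ , _ , ()

  hatBlock-owner : ∀ {i v} → v ∈ hatBlock i → hatOwner v ≡ i
  hatBlock-owner {i} v∈ with ∈-++⁻ (map inj₁ (pairBlock i)) v∈
  ... | inj₁ old-v with ∈-map⁻ inj₁ old-v
  ...   | _ , u∈ , refl = pairBlock-owner u∈
  hatBlock-owner {i} v∈ | inj₂ gadget-v with ∈-map⁻ (λ g → inj₂ (i , g)) gadget-v
  ...   | _ , _ , refl = refl

  hatBlock-complete : ∀ v → v ∈ hatBlock (hatOwner v)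
  hatBlock-complete (inj₁ u)       = ∈-++⁺ˡ (∈-map⁺ inj₁ (pairBlock-complete u))
  hatBlock-complete (inj₂ (i , g)) =
    ∈-++⁺ʳ (map inj₁ (pairBlock i)) (∈-map⁺ (λ h → inj₂ (i , h)) (gadgetVertices-complete g))

  hatEnumeration : Enumeration (HatV n)
  hatEnumeration =
    blockEnumeration (finEnumeration k) hatBlock hatOwner hatBlock-unique hatBlock-owner hatBlock-complete

  _≟Ĝ_ : DecidableEquality (HatV n)
  _≟Ĝ_ = Sum.≡-dec _≟ᶠ_ (Product.≡-dec _≟ᶠ_ _≟G_)

  length-indices : length (elements (finEnumeration k)) ≡ k
  length-indices = length-tabulate (λ i → i)

  module Forward (χ : Fin n → Bool) (χ-covers : Covers (Edge G) χ) where

    ψ : HatV n → Bool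
    ψ (inj₁ v)       = χ v
    ψ (inj₂ (i , g)) = gadgetChoice (χ (x' i)) g

    ψ-covers₀ : ∀ {u v} → HatEdge₀ G x x' u v → T (ψ u ∨ ψ v)
    ψ-covers₀ (old e _) = χ-covers _ _ e
    ψ-covers₀ (xs i) with χ (x' i) | χ-covers _ _ (matched i)
    ... | true  | _          = Equivalence.from (T-∨ {χ (x i)}) (inj₂ _)
    ... | false | x-selected = x-selected
    ψ-covers₀ (tx' i) with χ (x' i)
    ... | true  = _
    ... | false = _
    ψ-covers₀ (gad i e) = gadgetChoice-covers (χ (x' i)) e

    ψ-block : ∀ i → count ψ (hatBlock i) ≡ count χ (pairBlock i) +ℕ 4
    ψ-block i = begin
      ind (χ (x i)) +ℕ (ind (χ (x' i)) +ℕ count (gadgetChoice (χ (x' i))) gadgetVertices)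
        ≡⟨ cong (λ g → ind (χ (x i)) +ℕ (ind (χ (x' i)) +ℕ g)) (gadgetChoice-size (χ (x' i))) ⟩
      ind (χ (x i)) +ℕ (ind (χ (x' i)) +ℕ 4)
        ≡⟨ solve 2 (λ p q → p :+ (q :+ con 4) := (p :+ (q :+ con 0)) :+ con 4) refl (ind (χ (x i))) (ind (χ (x' i))) ⟩
      ind (χ (x i)) +ℕ (ind (χ (x' i)) +ℕ 0) +ℕ 4
        ∎
      where
      open ≡-Reasoning
      open +-*-Solver

  gadget-forward : ∀ χ → Covers (Edge G) χ →
    Σ (HatV n → Bool) λ ψ → Covers (HatEdge G x x') ψ ×
                            count ψ (elements hatEnumeration) ≤ count χ (elements vertexEnumeration) +ℕ k *ℕ 4
  gadget-forward χ χ-covers = ψ , Covers-symmetric {χ = ψ} ψ-covers₀ , ≤-reflexive size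
    where
    open Forward χ χ-covers
    size : count ψ (elements hatEnumeration) ≡ count χ (elements vertexEnumeration) +ℕ k *ℕ 4
    size = trans (count-blocks-≡ χ ψ pairBlock hatBlock 4 ψ-block (allFin k))
                 (cong (λ l → count χ (elements vertexEnumeration) +ℕ l *ℕ 4) length-indices)

  module Backward (ψ : HatV n → Bool) (ψ-covers : Covers (HatEdge G x x') ψ) where

    repair : Fin k ⊎ Fin k → Bool
    repair (inj₁ i) = not (ψ (inj₁ (x' i)))
    repair (inj₂ _) = false

    χ : Fin n → Bool
    χ v = ψ (inj₁ v) ∨ repair (side v)

    χ-x : ∀ i → χ (x i) ≡ ψ (inj₁ (x i)) ∨ not (ψ (inj₁ (x' i)))
    χ-x i = cong (λ p → ψ (inj₁ (x i)) ∨ repair p) (side-endpoint (inj₁ i))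

    χ-x' : ∀ i → χ (x' i) ≡ ψ (inj₁ (x' i))
    χ-x' i = trans (cong (λ p → ψ (inj₁ (x' i)) ∨ repair p) (side-endpoint (inj₂ i))) (∨-identityʳ _)

    ψ-covers₀ : ∀ {u v} → HatEdge₀ G x x' u v → T (ψ u ∨ ψ v)
    ψ-covers₀ e = ψ-covers _ _ (inj₁ e)

    matched-covered : ∀ i → T (χ (x i) ∨ χ (x' i))
    matched-covered i rewrite χ-x i | χ-x' i = repair-covers (ψ (inj₁ (x i))) (ψ (inj₁ (x' i)))

    inMatching? : ∀ u v → Dec (InMatching x x' u v)
    inMatching? u v = any? (λ i → ((x i ≟ᶠ u) ×-dec (x' i ≟ᶠ v)) ⊎-dec ((x i ≟ᶠ v) ×-dec (x' i ≟ᶠ u)))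

    -- matching edges are covered by the repair, all others survive in Ĝ
    χ-covers : Covers (Edge G) χ
    χ-covers u v e with inMatching? u v
    ... | yes (i , inj₁ (refl , refl)) = matched-covered i
    ... | yes (i , inj₂ (refl , refl)) = subst T (∨-comm (χ (x i)) (χ (x' i))) (matched-covered i)
    ... | no unmatched                 = ∨-weaken (ψ (inj₁ u)) (ψ (inj₁ v)) (ψ-covers₀ (old e unmatched))

    χ-block : ∀ i → count χ (pairBlock i) +ℕ 4 ≤ count ψ (hatBlock i)
    χ-block i = begin
      ind (χ (x i)) +ℕ (ind (χ (x' i)) +ℕ 0) +ℕ 4   ≡⟨ cong₂ (λ p q → ind p +ℕ (ind q +ℕ 0) +ℕ 4) (χ-x i) (χ-x' i) ⟩
      ind (cx ∨ not cx') +ℕ (ind cx' +ℕ 0) +ℕ 4      ≤⟨ repair-cost cx cx' (gadget-≥4 c covered) forced ⟩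
      ind cx +ℕ (ind cx' +ℕ count c gadgetVertices) ∎
      where
      open ≤-Reasoning
      cx cx' : Bool
      cx  = ψ (inj₁ (x i))
      cx' = ψ (inj₁ (x' i))
      c : Gadget → Bool
      c g = ψ (inj₂ (i , g))
      covered : GadgetCovered c
      covered = ψ-covers₀ ∘ gad i
      -- with x i and x' i unselected, the attaching edges force s and t
      forced : cx ≡ false → cx' ≡ false → 5 ≤ count c gadgetVertices
      forced cx≡false cx'≡false =
        gadget-≥5 c covered (resolveˡ cx≡false (ψ-covers₀ (xs i))) (resolveʳ cx'≡false (ψ-covers₀ (tx' i)))

  gadget-backward : ∀ ψ → Covers (HatEdge G x x') ψ →
    Σ (Fin n → Bool) λ χ → Covers (Edge G) χ ×
                           count χ (elements vertexEnumeration) +ℕ k *ℕ 4 ≤ count ψ (elements hatEnumeration)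
  gadget-backward ψ ψ-covers = χ , χ-covers , size
    where
    open Backward ψ ψ-covers
    size : count χ (elements vertexEnumeration) +ℕ k *ℕ 4 ≤ count ψ (elements hatEnumeration)
    size = subst (λ l → count χ (elements vertexEnumeration) +ℕ l *ℕ 4 ≤ count ψ (elements hatEnumeration))
                 length-indices (count-blocks-≤ χ ψ pairBlock hatBlock 4 χ-block (allFin k))

mainTheorem5 : (n : ℕ) (G : Graph n) → Cubic G → TwoConnected G → Planar G →
               (x x' : Fin (n / 2) → Fin n) → IsPerfectMatching G x x' →
               (p : ℤ) →
               HasVertexCoverOfSizeAtMost (Edge G) p ⇔
               HasVertexCoverOfSizeAtMost (HatEdge G x x') (p + (+ 2) * (+ n))
mainTheorem5 n G _ _ _ x x' matching p =
  subst (λ m → HasVertexCoverOfSizeAtMost (Edge G) p ⇔ HasVertexCoverOfSizeAtMost (HatEdge G x x') (p + m))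
        (sym twice-order)
        (coverSizes-shift vertexEnumeration _≟ᶠ_ hatEnumeration _≟Ĝ_ (k *ℕ 4) gadget-forward gadget-backward p)
  where open Matching {G = G} matching
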